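{- Let $\alpha,n\in\mathbb{Z}^+$ with $\alpha\mid n$, and let $\beta=n/\alpha$. Then \[|\mathcal{T}(\alpha,[n])|\le\big(\sigma_0(\alpha)\sigma_0(\beta)-\sigma_0(\alpha)-\sigma_0(\beta)+2\big)^{\log n}.\]
   Context: $[n]=\{1,\dots,n\}$, $\log=\log_2$, and $\sigma_0(m)$ is the number of positive divisors of $m$. $A+B$ is the Minkowski sum. For finite $C\subset\mathbb{Z}$ and $\alpha\in\mathbb{Z}^+$, $\mathcal{T}(\alpha,C)$ is the set of pairs $(A,B)$ of finite subsets of $\mathbb{Z}$ with $A+B=C$, $|C|=|A||B|$, $|A|=\alpha$, $0\in B$ and $\min B\ge0$. -}

module Defs where

open import Data.Nat as ℕ using (ℕ; suc; _∸_; _^_)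
open import Data.Nat.Divisibility using (_∣?_)
open import Data.Integer as ℤ using (ℤ; +_)
open import Data.List using (List; length; filter; applyUpTo)
open import Data.List.Membership.Propositional using (_∈_)
open import Data.List.Relation.Unary.All using (All)
open import Data.List.Relation.Unary.Linked using (Linked)
open import Data.Product using (_×_; ∃-syntax)
open import Relation.Binary.PropositionalEquality using (_≡_)
open import Function.Bundles using (_⇔_)

σ₀ : ℕ → ℕ
σ₀ m = length (filter (λ d → d ∣? m) (applyUpTo suc m))

-- A finite subset of ℤ is represented canonically by a strictly increasing list;
-- its cardinality is the length of that list.
FinSetℤ : List ℤ → Set
FinSetℤ = Linked ℤ._<_

In[_] : ℕ → ℤ → Set
In[ n ] z = (+ 1 ℤ.≤ z) × (z ℤ.≤ + n)

SumIsInterval : List ℤ → List ℤ → ℕ → Set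
SumIsInterval A B n =
  ∀ (z : ℤ) → In[ n ] z ⇔ (∃[ a ] ∃[ b ] (a ∈ A × b ∈ B × z ≡ a ℤ.+ b))

In𝒯 : ℕ → ℕ → List ℤ → List ℤ → Set
In𝒯 α n A B =
    FinSetℤ A × FinSetℤ B
  × SumIsInterval A B n
  × n ≡ length A ℕ.* length B
  × length A ≡ α
  × (+ 0) ∈ B
  × All (λ b → + 0 ℤ.≤ b) B

-- the base σ₀(α)σ₀(β) − σ₀(α) − σ₀(β) + 2 (a natural number ≥ 1; truncation never occurs)
base : ℕ → ℕ → ℕ
base α β = σ₀ α ℕ.* σ₀ β ℕ.+ 2 ∸ σ₀ α ∸ σ₀ β

-- t ≤ x ^ (log₂ n) for real exponent log₂ n (x ≥ 1), expressed through all rational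
-- upper bounds p/q ≥ log₂ n, i.e. n^q ≤ 2^p.
≤^log : ℕ → ℕ → ℕ → Set
≤^log t x n = ∀ (p q : ℕ) → n ^ suc q ℕ.≤ 2 ^ p → t ^ suc q ℕ.≤ x ^ p

-- By de Bruijn's description of the tilings of an interval, a direct sum X ⊕ Y = {0, …, n − 1}
-- with 1 ∈ X is determined by radices m₁, m₂, … ≥ 2 with product n: X consists of the numbers
-- whose mixed-radix digits vanish at the places 2, 4, … and Y of those whose digits vanish at the
-- places 1, 3, …. In particular m₁, m₃, … divide |X| and m₂, m₄, … divide |Y|. For
-- (A, B) ∈ 𝒯(α, [n]) take X = A − 1 and Y = B (swapped if 1 ∈ B). There are at most ⌊log n⌋
-- radices, and (A, B) is recovered from the pairs (m₁, m₂), (m₃, m₄), … (an unpaired last radix is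
-- determined by the product) together with the orientation. Padding with a blank symbol, this
-- encodes (A, B) injectively as a word of length ⌊log n⌋ over an alphabet of
-- 1 + (σ₀(α) − 1)(σ₀(β) − 1) letters.

module Submission where

open import Defs
open import Data.Nat using (ℕ; _≥_)
open import Data.Nat.Divisibility using (_∣_)
open import Data.Integer using (ℤ)
open _∣_ using (quotient)
open import Data.List using (List; length)
open import Data.List.Relation.Unary.All using (All)
open import Data.List.Relation.Unary.Unique.Propositional using (Unique)
open import Data.Product using (_×_; proj₁; proj₂)

open import Data.Bool as Bool using (Bool; true; false)
open import Data.Bool.Properties using (¬-not)
open import Data.Empty using (⊥; ⊥-elim)
open import Data.Integer as ℤ using (-[1+_])
import Data.Integer.Properties as ℤ
open import Data.List as List
  using ([]; _∷_; [_]; _++_; map; replicate; filter; applyUpTo; upTo; cartesianProductWith; cartesianProduct)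
open import Data.List.Properties as List
  using (length-++; length-map; length-upTo; length-replicate; ∷-injective; ∷-injectiveˡ; ∷-injectiveʳ; filter-accept)
open import Data.List.Membership.Propositional using (_∈_)
open import Data.List.Membership.Propositional.Properties
  using (∈-map⁺; ∈-map⁻; ∈-filter⁺; ∈-filter⁻; ∈-upTo⁺; ∈-upTo⁻; ∈-applyUpTo⁺;
         ∈-cartesianProductWith⁺; ∈-cartesianProduct⁺)
open import Data.List.Membership.DecPropositional ℤ._≟_ using () renaming (_∈?_ to _∈ℤ?_)
open import Data.List.Relation.Binary.Subset.Propositional using (_⊆_)
open import Data.List.Relation.Unary.All using ([]; _∷_)
import Data.List.Relation.Unary.All as All
import Data.List.Relation.Unary.All.Properties as AllP
open import Data.List.Relation.Unary.AllPairs as AllPairs using (AllPairs; []; _∷_)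
open import Data.List.Relation.Unary.Any using (here; there)
open import Data.List.Relation.Unary.Linked.Properties using (Linked⇒AllPairs)
import Data.List.Relation.Unary.Unique.Propositional.Properties as Unique
open import Data.Maybe using (Maybe; just; nothing)
open import Data.Nat as ℕ
  using (zero; suc; pred; _+_; _*_; _∸_; _^_; _≤_; _<_; z≤n; s≤s; s≤s⁻¹; z<s; s<s;
         _≟_; _≤?_; _<?_; >-nonZero; ⌊_/2⌋; ⌈_/2⌉)
open import Data.Nat.Properties
open import Data.Nat.DivMod using (_/_; _%_; m≡m%n+[m/n]*n; m%n<n)
open import Data.Nat.Divisibility using (_∣?_; ∣⇒≤; 1∣_; ∣-trans; ∣-reflexive; m∣m*n; n∣m*n)
open import Data.Nat.Induction using (<-rec)
open import Data.Nat.ListAction using (product)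
open import Data.Nat.Logarithm using (⌊log₂_⌋; ⌊log₂⌋-mono-≤; ⌊log₂[2^n]⌋≡n; ⌊log₂⌊n/2⌋⌋≡⌊log₂n⌋∸1)
open import Data.Nat.Tactic.RingSolver using (solve-∀)
open import Data.Product using (∃; ∃₂; _,_; uncurry; swap)
open import Data.Product.Properties using () renaming (≡-dec to ×-≡-dec)
open import Data.Sum using (_⊎_; inj₁; inj₂)
open import Data.Unit using (⊤; tt)
open import Function using (_∘_; id)
open import Function.Bundles using (_⇔_; mk⇔; Equivalence)
open import Level using (0ℓ)
open import Relation.Binary using (Rel; Irreflexive; Asymmetric; DecidableEquality)
open import Relation.Binary.PropositionalEquality
  using (_≡_; _≢_; refl; sym; trans; cong; cong₂; subst; subst₂; module ≡-Reasoning)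
open import Relation.Nullary using (yes; no; does)
open import Relation.Nullary.Decidable using (dec-true)

remove-∈ : {A : Set} {x : A} {ys : List A} → x ∈ ys →
  ∃ λ zs → length ys ≡ suc (length zs) × (∀ {z} → z ∈ ys → z ≢ x → z ∈ zs)
remove-∈ {ys = _ ∷ ys} (here refl) = ys , refl , λ where
  (here refl) z≢x → ⊥-elim (z≢x refl)
  (there z∈)  _   → z∈
remove-∈ {ys = y ∷ _} (there x∈) with zs , len , sub ← remove-∈ x∈ =
  y ∷ zs , cong suc len , λ where
    (here refl) _   → here refl
    (there z∈)  z≢x → there (sub z∈ z≢x)

Unique-⊆⇒length-≤ : {A : Set} {xs ys : List A} → Unique xs → xs ⊆ ys → length xs ≤ length ys
Unique-⊆⇒length-≤ {xs = []} _ _ = z≤n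
Unique-⊆⇒length-≤ {xs = x ∷ xs} (x∉xs ∷ xs!) xs⊆ys
  with zs , len , sub ← remove-∈ (xs⊆ys (here refl)) =
  subst (suc (length xs) ≤_) (sym len) (s≤s (Unique-⊆⇒length-≤ xs! xs⊆zs))
  where
    xs⊆zs : xs ⊆ zs
    xs⊆zs z∈ = sub (xs⊆ys (there z∈)) (λ z≡x → All.lookup x∉xs z∈ (sym z≡x))

Unique-⊆-⊇⇒length-≡ : {A : Set} {xs ys : List A} → Unique xs → Unique ys →
  xs ⊆ ys → ys ⊆ xs → length xs ≡ length ys
Unique-⊆-⊇⇒length-≡ xs! ys! xs⊆ys ys⊆xs =
  ≤-antisym (Unique-⊆⇒length-≤ xs! xs⊆ys) (Unique-⊆⇒length-≤ ys! ys⊆xs)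

⊆-map⇒injective : {A B : Set} → DecidableEquality A → (f : A → B) {xs : List A} {ys : List B} →
  Unique ys → ys ⊆ map f xs → length xs ≤ length ys →
  ∀ {x x'} → x ∈ xs → x' ∈ xs → f x ≡ f x' → x ≡ x'
⊆-map⇒injective _≟_ f {xs} {ys} ys! ys⊆ |xs|≤|ys| {x} {x'} x∈ x'∈ fx≡fx' with x ≟ x'
... | yes x≡x' = x≡x'
... | no x≢x' with zs , len , sub ← remove-∈ x∈ = ⊥-elim (<⇒≱ |zs|<|xs| |xs|≤|zs|)
  where
    ys⊆zs : ys ⊆ map f zs
    ys⊆zs y∈ with s , s∈ , refl ← ∈-map⁻ f (ys⊆ y∈) with s ≟ x
    ... | yes refl = subst (_∈ map f zs) (sym fx≡fx') (∈-map⁺ f (sub x'∈ (x≢x' ∘ sym)))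
    ... | no s≢x = ∈-map⁺ f (sub s∈ s≢x)
    |zs|<|xs| : length zs < length xs
    |zs|<|xs| = ≤-reflexive (sym len)
    |xs|≤|zs| : length xs ≤ length zs
    |xs|≤|zs| = ≤-trans |xs|≤|ys|
      (subst (length ys ≤_) (length-map f zs) (Unique-⊆⇒length-≤ ys! ys⊆zs))

module _ {A B : Set} {P : A → Set} (f : ∀ {x} → P x → B)
         (f-injective : ∀ {x y} (p : P x) (q : P y) → f p ≡ f q → x ≡ y) where

  private
    reduce-∉ : ∀ {x xs} (p : P x) (ps : All P xs) → All (x ≢_) xs → All (f p ≢_) (All.reduce f ps)
    reduce-∉ p []       []          = []
    reduce-∉ p (q ∷ ps) (x≢y ∷ x∉) = (x≢y ∘ f-injective p q) ∷ reduce-∉ p ps x∉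

    Unique-reduce : ∀ {xs} → Unique xs → (ps : All P xs) → Unique (All.reduce f ps)
    Unique-reduce []          []       = []
    Unique-reduce (x∉ ∷ xs!) (p ∷ ps) = reduce-∉ p ps x∉ ∷ Unique-reduce xs! ps

    length-reduce : ∀ {xs} (ps : All P xs) → length (All.reduce f ps) ≡ length xs
    length-reduce []       = refl
    length-reduce (_ ∷ ps) = cong suc (length-reduce ps)

  length-≤-by-injection : ∀ {xs} {ws : List B} → Unique xs → All P xs →
    (∀ {x} (p : P x) → f p ∈ ws) → length xs ≤ length ws
  length-≤-by-injection {ws = ws} xs! ps f∈ws = subst (_≤ _) (length-reduce ps)
    (Unique-⊆⇒length-≤ (Unique-reduce xs! ps) (reduce-⊆ ps))
    where
      reduce-⊆ : ∀ {xs} (ps : All P xs) → All.reduce f ps ⊆ ws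
      reduce-⊆ (p ∷ _)  (here refl) = f∈ws p
      reduce-⊆ (_ ∷ ps) (there y∈)  = reduce-⊆ ps y∈

length-cartesianProductWith : {A B C : Set} (f : A → B → C) (xs : List A) (ys : List B) →
  length (cartesianProductWith f xs ys) ≡ length xs * length ys
length-cartesianProductWith f []       ys = refl
length-cartesianProductWith f (x ∷ xs) ys = begin
  length (map (f x) ys ++ cartesianProductWith f xs ys)      ≡⟨ length-++ (map (f x) ys) ⟩
  length (map (f x) ys) + length (cartesianProductWith f xs ys)
    ≡⟨ cong₂ _+_ (length-map (f x) ys) (length-cartesianProductWith f xs ys) ⟩
  length ys + length xs * length ys                           ∎
  where open ≡-Reasoning

words : {A : Set} → ℕ → List A → List (List A)
words zero    S = [ [] ]
words (suc e) S = cartesianProductWith _∷_ S (words e S)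

length-words : {A : Set} (e : ℕ) (S : List A) → length (words e S) ≡ length S ^ e
length-words zero    S = refl
length-words (suc e) S = trans (length-cartesianProductWith _∷_ S (words e S))
                               (cong (length S *_) (length-words e S))

∈-words : {A : Set} {S : List A} (w : List A) → All (_∈ S) w → w ∈ words (length w) S
∈-words []      []          = here refl
∈-words (s ∷ w) (s∈ ∷ w⊆S) = ∈-cartesianProductWith⁺ _∷_ s∈ (∈-words w w⊆S)

module _ {A : Set} {_<_ : Rel A 0ℓ} (<-irrefl : Irreflexive _≡_ _<_) (<-asym : Asymmetric _<_) where

  private
    heads-≡ : ∀ {x y xs ys} → All (x <_) xs → All (y <_) ys → x ∈ y ∷ ys → y ∈ x ∷ xs → x ≡ y
    heads-≡ _    _    (here x≡y) _          = x≡y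
    heads-≡ _    _    (there _)  (here y≡x) = sym y≡x
    heads-≡ x<xs y<ys (there x∈) (there y∈) = ⊥-elim (<-asym (All.lookup y<ys x∈) (All.lookup x<xs y∈))

    ⊆-tail : ∀ {x xs ys} → All (x <_) xs → x ∷ xs ⊆ x ∷ ys → xs ⊆ ys
    ⊆-tail x<xs sub z∈ with sub (there z∈)
    ... | here refl  = ⊥-elim (<-irrefl refl (All.lookup x<xs z∈))
    ... | there z∈ys = z∈ys

  sorted-⊆-⊇⇒≡ : ∀ {xs ys} → AllPairs _<_ xs → AllPairs _<_ ys → xs ⊆ ys → ys ⊆ xs → xs ≡ ys
  sorted-⊆-⊇⇒≡ {[]}    {[]}    _ _ _ _ = refl
  sorted-⊆-⊇⇒≡ {[]}    {_ ∷ _} _ _ _ ys⊆xs with () ← ys⊆xs (here refl)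
  sorted-⊆-⊇⇒≡ {_ ∷ _} {[]}    _ _ xs⊆ys _ with () ← xs⊆ys (here refl)
  sorted-⊆-⊇⇒≡ {x ∷ _} {_ ∷ _} (x<xs ∷ xs<) (y<ys ∷ ys<) xs⊆ys ys⊆xs
    with refl ← heads-≡ x<xs y<ys (xs⊆ys (here refl)) (ys⊆xs (here refl)) =
    cong (x ∷_) (sorted-⊆-⊇⇒≡ xs< ys< (⊆-tail x<xs xs⊆ys) (⊆-tail y<ys ys⊆xs))

bit : Bool → ℕ
bit true  = 1
bit false = 0

count : ℕ → (ℕ → Bool) → ℕ
count zero    p = 0
count (suc N) p = bit (p 0) + count N (p ∘ suc)

count-+ : ∀ a b p → count (a + b) p ≡ count a p + count b (λ z → p (a + z))
count-+ zero    b p = refl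
count-+ (suc a) b p = trans (cong (bit (p 0) +_) (count-+ a b (p ∘ suc))) (sym (+-assoc (bit (p 0)) _ _))

count-cong : ∀ N {p q} → (∀ z → z < N → p z ≡ q z) → count N p ≡ count N q
count-cong zero    _   = refl
count-cong (suc N) p≗q = cong₂ _+_ (cong bit (p≗q 0 z<s)) (count-cong N (λ z z<N → p≗q (suc z) (s<s z<N)))

count-const : ∀ N {p} b → (∀ z → z < N → p z ≡ b) → count N p ≡ N * bit b
count-const zero    b _    = refl
count-const (suc N) b p≡b = cong₂ _+_ (cong bit (p≡b 0 z<s)) (count-const N b (λ z z<N → p≡b (suc z) (s<s z<N)))

private
  block-shift : ∀ m j i → m + (m * j + i) ≡ m * suc j + i
  block-shift = solve-∀

  count-next-block : ∀ m N p → count (m * suc N) p ≡ count m p + count (m * N) (λ z → p (m + z))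
  count-next-block m N p = trans (cong (λ k → count k p) (*-suc m N)) (count-+ m (m * N) p)

count-blocks : ∀ m N p q → (∀ j i → i < m → p (m * j + i) ≡ q j) → count (m * N) p ≡ m * count N q
count-blocks m zero    p q _ rewrite *-zeroʳ m = refl
count-blocks m (suc N) p q blocks = begin
  count (m * suc N) p                                        ≡⟨ count-next-block m N p ⟩
  count m p + count (m * N) (λ z → p (m + z))
    ≡⟨ cong₂ _+_ (count-const m (q 0) first-block) (count-blocks m N _ (q ∘ suc) later-blocks) ⟩
  m * bit (q 0) + m * count N (q ∘ suc)                      ≡⟨ *-distribˡ-+ m (bit (q 0)) _ ⟨
  m * count (suc N) q                                        ∎
  where
    open ≡-Reasoning
    first-block : ∀ i → i < m → p i ≡ q 0
    first-block i i<m = trans (cong p (cong (_+ i) (sym (*-zeroʳ m)))) (blocks 0 i i<m)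
    later-blocks : ∀ j i → i < m → p (m + (m * j + i)) ≡ q (suc j)
    later-blocks j i i<m = trans (cong p (block-shift m j i)) (blocks (suc j) i i<m)

count-block-starts : ∀ m₀ N p → (∀ j i → 0 < i → i < suc m₀ → p (suc m₀ * j + i) ≡ false) →
  count (suc m₀ * N) p ≡ count N (λ j → p (suc m₀ * j))
count-block-starts m₀ zero    p _ rewrite *-zeroʳ m₀ = refl
count-block-starts m₀ (suc N) p sparse = begin
  count (m * suc N) p                                         ≡⟨ count-next-block m N p ⟩
  (bit (p 0) + count m₀ (p ∘ suc)) + count (m * N) (λ z → p (m + z))
    ≡⟨ cong₂ _+_ (cong₂ _+_ (cong (bit ∘ p) (sym (*-zeroʳ m))) (count-const m₀ false first-block))
                 (trans (count-block-starts m₀ N _ later-blocks)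
                        (count-cong N (λ j _ → cong p (sym (*-suc m j))))) ⟩
  (bit (p (m * 0)) + m₀ * 0) + count N (λ j → p (m * suc j))
    ≡⟨ cong (λ k → k + count N (λ j → p (m * suc j))) (trans (cong (bit (p (m * 0)) +_) (*-zeroʳ m₀)) (+-identityʳ _)) ⟩
  count (suc N) (λ j → p (m * j))                             ∎
  where
    open ≡-Reasoning
    m = suc m₀
    first-block : ∀ i → i < m₀ → p (suc i) ≡ false
    first-block i i<m₀ = trans (cong p (cong (_+ suc i) (sym (*-zeroʳ m)))) (sparse 0 (suc i) z<s (s<s i<m₀))
    later-blocks : ∀ j i → 0 < i → i < m → p (m + (m * j + i)) ≡ false
    later-blocks j i 0<i i<m = trans (cong p (block-shift m j i)) (sparse (suc j) i 0<i i<m)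

-- Tilings of an interval

record Tiling (n : ℕ) (X Y : ℕ → Bool) : Set where
  field
    cover  : ∀ z → z < n → ∃₂ λ x y → X x ≡ true × Y y ≡ true × z ≡ x + y
    sum<n  : ∀ {x y} → X x ≡ true → Y y ≡ true → x + y < n
    unique : ∀ {x y x' y'} → X x ≡ true → Y y ≡ true → X x' ≡ true → Y y' ≡ true →
             x + y ≡ x' + y' → x ≡ x'

false⇒≢true : ∀ {b} → b ≡ false → b ≢ true
false⇒≢true refl ()

module TilingProperties {n X Y} (T : Tiling n X Y) where
  open Tiling T

  unique′ : ∀ {x y x' y'} → X x ≡ true → Y y ≡ true → X x' ≡ true → Y y' ≡ true →
            x + y ≡ x' + y' → y ≡ y'
  unique′ Xx Yy Xx' Yy' eq with refl ← unique Xx Yy Xx' Yy' eq = +-cancelˡ-≡ _ _ _ eq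

  X-one : 1 < n → Y 1 ≡ false → X 1 ≡ true
  X-one 1<n Y-one with x , y , Xx , Yy , 1≡x+y ← cover 1 1<n with y
  ... | zero        = subst (λ z → X z ≡ true) (sym (trans 1≡x+y (+-identityʳ x))) Xx
  ... | suc zero    = ⊥-elim (false⇒≢true Y-one Yy)
  ... | suc (suc w) = ⊥-elim (<⇒≱ (s<s z<s) (subst (suc (suc w) ≤_) (sym 1≡x+y) (m≤n+m _ x)))

  module Nonempty (0<n : 0 < n) where
    X-zero : X 0 ≡ true
    X-zero with x , y , Xx , _ , 0≡x+y ← cover 0 0<n = subst (λ z → X z ≡ true) (m+n≡0⇒m≡0 x (sym 0≡x+y)) Xx

    Y-zero : Y 0 ≡ true
    Y-zero with x , y , _ , Yy , 0≡x+y ← cover 0 0<n = subst (λ z → Y z ≡ true) (m+n≡0⇒n≡0 x (sym 0≡x+y)) Yy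

    X-< : ∀ {x} → X x ≡ true → x < n
    X-< {x} Xx = subst (_< n) (+-identityʳ x) (sum<n Xx Y-zero)

    Y-< : ∀ {y} → Y y ≡ true → y < n
    Y-< Yy = sum<n X-zero Yy

    X-≥ : ∀ {z} → n ≤ z → X z ≡ false
    X-≥ {z} n≤z with X z in Xz
    ... | false = refl
    ... | true  = ⊥-elim (<⇒≱ (X-< Xz) n≤z)

    Y-≥ : ∀ {z} → n ≤ z → Y z ≡ false
    Y-≥ {z} n≤z with Y z in Yz
    ... | false = refl
    ... | true  = ⊥-elim (<⇒≱ (Y-< Yz) n≤z)

    X∩Y⊆0 : ∀ {z} → X z ≡ true → Y z ≡ true → z ≡ 0
    X∩Y⊆0 {z} Xz Yz = unique Xz Y-zero X-zero Yz (+-identityʳ z)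

swap-tiling : ∀ {n X Y} → Tiling n X Y → Tiling n Y X
swap-tiling {n} T = record
  { cover  = λ z z<n → let x , y , Xx , Yy , eq = cover z z<n in y , x , Yy , Xx , trans eq (+-comm x _)
  ; sum<n  = λ {y} {x} Yy Xx → subst (_< n) (+-comm x y) (sum<n Xx Yy)
  ; unique = λ {y} {x} {y'} {x'} Yy Xx Yy' Xx' eq →
      unique′ Xx Yy Xx' Yy' (trans (+-comm x y) (trans eq (+-comm y' x')))
  }
  where
    open Tiling T
    open TilingProperties T using (unique′)

-- The block structure of a tiling

least-false : (p : ℕ → Bool) {k : ℕ} → p k ≡ false →
  ∃ λ m → (∀ z → z < m → p z ≡ true) × p m ≡ false
least-false p {k} pk with p 0 in p0
... | false = 0 , (λ _ ()) , p0
least-false p {zero}  pk | true = ⊥-elim (false⇒≢true pk p0)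
least-false p {suc k} pk | true with m , below , pm ← least-false (p ∘ suc) pk = suc m , below′ , pm
  where
    below′ : ∀ z → z < suc m → p z ≡ true
    below′ zero    _         = p0
    below′ (suc z) (s<s z<m) = below z z<m

+-*-∸-cancel : ∀ m {x i j k} → j ≤ k → x + m * j ≡ m * k + i → x ≡ m * (k ∸ j) + i
+-*-∸-cancel m {x} {i} {j} {k} j≤k eq = +-cancelʳ-≡ (m * j) x (m * (k ∸ j) + i) (begin
  x + m * j                ≡⟨ eq ⟩
  m * k + i                ≡⟨ cong (λ l → m * l + i) (m∸n+n≡m j≤k) ⟨
  m * (k ∸ j + j) + i      ≡⟨ rearrange m (k ∸ j) j i ⟩
  m * (k ∸ j) + i + m * j  ∎)
  where
    open ≡-Reasoning
    rearrange : ∀ m a j i → m * (a + j) + i ≡ m * a + i + m * j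
    rearrange = solve-∀

-- If X ⊕ Y = [0, n), [0, m) ⊆ X and m ∉ X, then X is constant on each block [m j, m j + m)
-- and Y consists of multiples of m.
module BlockStructure {n X Y} (T : Tiling n X Y) (0<n : 0 < n) (m₀ : ℕ)
  (X-initial : ∀ z → z < suc m₀ → X z ≡ true) (X-m : X (suc m₀) ≡ false) where

  open Tiling T
  open TilingProperties T
  open TilingProperties.Nonempty T 0<n

  m : ℕ
  m = suc m₀

  q r : ℕ → ℕ
  q w = w / m
  r w = w % m

  div-mod : ∀ w → w ≡ m * q w + r w
  div-mod w = trans (m≡m%n+[m/n]*n w m) (trans (+-comm (r w) _) (cong (_+ r w) (*-comm (q w) m)))

  r<m : ∀ w → r w < m
  r<m w = m%n<n w m

  Y-m : m < n → Y m ≡ true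
  Y-m m<n with cover m m<n
  ... | x , y , Xx , Yy , m≡x+y with y ≟ 0 | m≤n⇒m<n∨m≡n (subst (y ≤_) (sym m≡x+y) (m≤n+m y x))
  ...   | yes refl | _ = ⊥-elim (false⇒≢true X-m (subst (λ z → X z ≡ true) (sym (trans m≡x+y (+-identityʳ x))) Xx))
  ...   | no y≢0 | inj₁ y<m = ⊥-elim (y≢0 (X∩Y⊆0 (X-initial y y<m) Yy))
  ...   | no _   | inj₂ refl = Yy

  BlockShape : ℕ → Set
  BlockShape j = ∀ i → i < m → X (m * j + i) ≡ X (m * j) × (Y (m * j + i) ≡ true → i ≡ 0)

  X-by-shape : ∀ z → BlockShape (q z) → X z ≡ X (m * q z)
  X-by-shape z shape = trans (cong X (div-mod z)) (proj₁ (shape (r z) (r<m z)))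

  Y-by-shape : ∀ {z} → BlockShape (q z) → Y z ≡ true → z ≡ m * q z
  Y-by-shape {z} shape Yz = trans (div-mod z) (trans (cong (m * q z +_) r≡0) (+-identityʳ _))
    where
      r≡0 : r z ≡ 0
      r≡0 = proj₂ (shape (r z) (r<m z)) (trans (cong Y (sym (div-mod z))) Yz)

  initial-block : BlockShape 0
  initial-block i i<m rewrite *-zeroʳ m =
    trans (X-initial i i<m) (sym (X-initial 0 z<s)) , X∩Y⊆0 (X-initial i i<m)

  outside-block : ∀ {k} → n ≤ m * k → BlockShape k
  outside-block {k} n≤mk i i<m =
    trans (X-≥ n≤mk+i) (sym (X-≥ n≤mk)) , λ Y-true → ⊥-elim (false⇒≢true (Y-≥ n≤mk+i) Y-true)
    where
      n≤mk+i : n ≤ m * k + i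
      n≤mk+i = ≤-trans n≤mk (m≤m+n (m * k) i)

  m≤m* : ∀ {k} → 1 ≤ k → m ≤ m * k
  m≤m* {k} 1≤k = m≤m*n m k ⦃ >-nonZero 1≤k ⦄

  no-Y-in-X-block : ∀ {k i} → 1 ≤ k → X (m * k) ≡ true → i < m → Y (m * k + i) ≡ true → ⊥
  no-Y-in-X-block {k} {zero} 1≤k Xmk _ Ymk =
    <⇒≢ (<-≤-trans z<s (m≤m* 1≤k)) (sym (X∩Y⊆0 Xmk (subst (λ z → Y z ≡ true) (+-identityʳ _) Ymk)))
  -- (m − i) + (m k + i) = m k + m exhibits two representations of m k + m
  no-Y-in-X-block {k} {suc i} 1≤k Xmk i<m Ymki =
    <⇒≱ (<-≤-trans (s<s (m∸n≤m m₀ i)) m≤mk) (≤-reflexive (sym m-i≡mk))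
    where
      m≤mk : m ≤ m * k
      m≤mk = m≤m* 1≤k
      exchange : ∀ d b s → d + (b + s) ≡ b + (d + s)
      exchange = solve-∀
      m-i≡mk : m ∸ suc i ≡ m * k
      m-i≡mk = unique (X-initial (m ∸ suc i) (s<s (m∸n≤m m₀ i))) Ymki Xmk (Y-m (≤-<-trans m≤mk (X-< Xmk)))
        (trans (exchange (m ∸ suc i) (m * k) (suc i)) (cong (m * k +_) (m∸n+n≡m (<⇒≤ i<m))))

  module _ {k} (IH : ∀ {j} → j < k → BlockShape j) where

    private
      q<k : ∀ {w} → w < m * k → q w < k
      q<k {w} w<mk = *-cancelˡ-< m (q w) k
        (≤-<-trans (m≤m+n (m * q w) (r w)) (subst (_< m * k) (div-mod w) w<mk))

    split-below : ∀ {x y i} → y < m * k → y ≢ 0 → Y y ≡ true → x + y ≡ m * k + i →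
      ∃ λ j → k ∸ j < k × j ≤ k × Y (m * j) ≡ true × x ≡ m * (k ∸ j) + i
    split-below {x} {y} y<mk y≢0 Yy sum =
      q y , ∸-monoʳ-< 0<qy qy≤k , qy≤k , subst (λ z → Y z ≡ true) y≡m*qy Yy ,
      +-*-∸-cancel m qy≤k (trans (cong (x +_) (sym y≡m*qy)) sum)
      where
        y≡m*qy : y ≡ m * q y
        y≡m*qy = Y-by-shape (IH (q<k y<mk)) Yy
        qy≤k : q y ≤ k
        qy≤k = <⇒≤ (q<k y<mk)
        0<qy : 0 < q y
        0<qy = n≢0⇒n>0 (λ qy≡0 → y≢0 (trans y≡m*qy (trans (cong (m *_) qy≡0) (*-zeroʳ m))))

    X-below : ∀ {x i} j → k ∸ j < k → i < m → x ≡ m * (k ∸ j) + i → X x ≡ X (m * (k ∸ j))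
    X-below _ k∸j<k i<m refl = proj₁ (IH k∸j<k _ i<m)

    gap-cover : X (m * k) ≡ false → m * k < n →
      ∃₂ λ t y → (∀ i → i < m → X (t + i) ≡ true) × Y y ≡ true × y ≢ 0 × t + y ≡ m * k
    gap-cover Xmk mk<n with cover (m * k) mk<n
    ... | x , y , Xx , Yy , mk≡x+y with y ≟ 0 | m≤n⇒m<n∨m≡n (subst (y ≤_) (sym mk≡x+y) (m≤n+m y x))
    ...   | yes refl | _ = ⊥-elim (false⇒≢true Xmk (subst (λ z → X z ≡ true) (sym (trans mk≡x+y (+-identityʳ x))) Xx))
    ...   | no y≢0 | inj₂ refl = 0 , y , X-initial , Yy , y≢0 , refl
    ...   | no y≢0 | inj₁ y<mk
      with j , k∸j<k , _ , _ , x≡ ← split-below y<mk y≢0 Yy (trans (sym mk≡x+y) (sym (+-identityʳ _))) =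
      x , y , X-block , Yy , y≢0 , sym mk≡x+y
      where
        x≡ᵇ : x ≡ m * (k ∸ j)
        x≡ᵇ = trans x≡ (+-identityʳ _)
        X-block : ∀ i → i < m → X (x + i) ≡ true
        X-block i i<m = begin
          X (x + i)            ≡⟨ X-below j k∸j<k i<m (cong (_+ i) x≡ᵇ) ⟩
          X (m * (k ∸ j))      ≡⟨ cong X x≡ᵇ ⟨
          X x                  ≡⟨ Xx ⟩
          true                 ∎
          where open ≡-Reasoning

    gap-block : X (m * k) ≡ false → m * k < n → BlockShape k
    gap-block Xmk mk<n i i<m with t , y , X-block , Yy , y≢0 , t+y≡mk ← gap-cover Xmk mk<n =
      trans (¬-not X-not) (sym Xmk) , Y-start
      where
        shift : (t + i) + y ≡ m * k + i
        shift = trans (+-assoc t i y) (trans (cong (t +_) (+-comm i y))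
                  (trans (sym (+-assoc t y i)) (cong (_+ i) t+y≡mk)))
        X-not : X (m * k + i) ≢ true
        X-not Xmki = y≢0 (+-cancelˡ-≡ t y 0 (trans t+y≡mk (sym (trans (+-identityʳ t) t≡mk))))
          where
            t≡mk : t ≡ m * k
            t≡mk = +-cancelʳ-≡ i t (m * k)
              (unique (X-block i i<m) Yy Xmki Y-zero (trans shift (sym (+-identityʳ _))))
        Y-start : Y (m * k + i) ≡ true → i ≡ 0
        Y-start Ymki = m+n≡0⇒n≡0 t (unique (X-block i i<m) Yy X-zero Ymki shift)

    X-block-full : 1 ≤ k → X (m * k) ≡ true → ∀ i → i < m → X (m * k + i) ≢ false
    X-block-full 1≤k Xmk i i<m Xmki with cover (m * k + i) mki<n
      where
        mki<n : m * k + i < n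
        mki<n = <-trans (+-monoʳ-< (m * k) i<m)
                  (sum<n Xmk (Y-m (≤-<-trans (m≤m* 1≤k) (X-< Xmk))))
    ... | x , y , Xx , Yy , mki≡x+y with y ≟ 0 | m * k ≤? y
    ...   | yes refl | _ =
      false⇒≢true Xmki (subst (λ z → X z ≡ true) (sym (trans mki≡x+y (+-identityʳ x))) Xx)
    ...   | no _ | yes mk≤y = no-Y-in-X-block 1≤k Xmk y∸mk<m (subst (λ z → Y z ≡ true) (sym (m+[n∸m]≡n mk≤y)) Yy)
      where
        y∸mk<m : y ∸ m * k < m
        y∸mk<m = ≤-<-trans (subst (y ∸ m * k ≤_) (m+n∸m≡n (m * k) i)
                   (∸-monoˡ-≤ (m * k) (subst (y ≤_) (sym mki≡x+y) (m≤n+m y x)))) i<m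
    ...   | no y≢0 | no mk≰y
      with j , k∸j<k , j≤k , Ymj , x≡ ← split-below (≰⇒> mk≰y) y≢0 Yy (sym mki≡x+y) =
      <⇒≢ (*-monoʳ-< m k∸j<k) (unique X-start Ymj Xmk Y-zero blocks)
      where
        X-start : X (m * (k ∸ j)) ≡ true
        X-start = trans (sym (X-below j k∸j<k i<m x≡)) Xx
        blocks : m * (k ∸ j) + m * j ≡ m * k + 0
        blocks = trans (sym (*-distribˡ-+ m (k ∸ j) j))
                   (trans (cong (m *_) (m∸n+n≡m j≤k)) (sym (+-identityʳ _)))

    X-block : 1 ≤ k → X (m * k) ≡ true → BlockShape k
    X-block 1≤k Xmk i i<m =
      trans (¬-not (X-block-full 1≤k Xmk i i<m)) (sym Xmk) ,
      λ Ymki → ⊥-elim (no-Y-in-X-block 1≤k Xmk i<m Ymki)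

  blockShape : ∀ j → BlockShape j
  blockShape = <-rec BlockShape shape
    where
      shape : ∀ k → (∀ {j} → j < k → BlockShape j) → BlockShape k
      shape zero    _  = initial-block
      shape (suc k) IH with m * suc k <? n
      ... | no  mk≮n = outside-block (≮⇒≥ mk≮n)
      ... | yes mk<n with X (m * suc k) Bool.≟ true
      ...   | yes Xmk = X-block IH z<s Xmk
      ...   | no  Xmk = gap-block IH (¬-not Xmk) mk<n

  X-blockwise : ∀ z → X z ≡ X (m * q z)
  X-blockwise z = X-by-shape z (blockShape (q z))

  Y-multiple : ∀ {z} → Y z ≡ true → z ≡ m * q z
  Y-multiple = Y-by-shape (blockShape _)

  -- Write n − 1 = x + y: x's whole block lies in X, so x is the last point of its block.
  m∣n : ∃ λ n₁ → n ≡ m * n₁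
  m∣n with x , y , Xx , Yy , n-1≡x+y ← cover (pred n) (≤-reflexive (suc-pred n ⦃ >-nonZero 0<n ⦄)) =
    suc (q x + q y) , trans (≤-antisym n≤top+1 top<n) (last-block m₀ (q x) (q y))
    where
      top : ℕ
      top = (m * q x + m₀) + m * q y
      X-top : X (m * q x + m₀) ≡ true
      X-top = trans (proj₁ (blockShape (q x) m₀ ≤-refl)) (trans (sym (X-blockwise x)) Xx)
      top<n : suc top ≤ n
      top<n = subst (λ y′ → (m * q x + m₀) + y′ < n) (Y-multiple Yy) (sum<n X-top Yy)
      x+y≤top : x + y ≤ top
      x+y≤top = subst₂ (λ x′ y′ → x′ + y′ ≤ top) (sym (div-mod x)) (sym (Y-multiple Yy))
        (+-monoˡ-≤ (m * q y) (+-monoʳ-≤ (m * q x) (s≤s⁻¹ (r<m x))))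
      n≤top+1 : n ≤ suc top
      n≤top+1 = subst (_≤ suc top) (suc-pred n ⦃ >-nonZero 0<n ⦄) (s≤s (subst (_≤ top) (sym n-1≡x+y) x+y≤top))
      last-block : ∀ m₀ a b → suc ((suc m₀ * a + m₀) + suc m₀ * b) ≡ suc m₀ * suc (a + b)
      last-block = solve-∀

  n₁ : ℕ
  n₁ = proj₁ m∣n

  n≡m*n₁ : n ≡ m * n₁
  n≡m*n₁ = proj₂ m∣n

  0<n₁ : 0 < n₁
  0<n₁ = n≢0⇒n>0 λ n₁≡0 → <⇒≢ 0<n (sym (trans n≡m*n₁ (trans (cong (m *_) n₁≡0) (*-zeroʳ m))))

  n₁<n : 1 ≤ m₀ → n₁ < n
  n₁<n 1≤m₀ = subst (n₁ <_) (trans (*-comm n₁ m) (sym n≡m*n₁)) (m<m*n n₁ m ⦃ >-nonZero 0<n₁ ⦄ (s≤s 1≤m₀))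

  X₁ Y₁ : ℕ → Bool
  X₁ k = X (m * k)
  Y₁ k = Y (m * k)

  X₁-one : X₁ 1 ≡ false
  X₁-one = trans (cong X (*-identityʳ m)) X-m

  private
    m*-+ : ∀ u v → m * v + m * u ≡ m * (u + v)
    m*-+ u v = trans (+-comm (m * v) (m * u)) (sym (*-distribˡ-+ m u v))

  reduced : Tiling n₁ Y₁ X₁
  reduced = record { cover = cover₁ ; sum<n = sum<n₁ ; unique = unique₁ }
    where
      cover₁ : ∀ k → k < n₁ → ∃₂ λ u v → Y₁ u ≡ true × X₁ v ≡ true × k ≡ u + v
      cover₁ k k<n₁ with x , y , Xx , Yy , mk≡x+y ← cover (m * k) (subst (m * k <_) (sym n≡m*n₁) (*-monoʳ-< m k<n₁)) =
        q y , k ∸ q y , subst (λ z → Y z ≡ true) y≡ Yy , subst (λ z → X z ≡ true) x≡ Xx , sym (m+[n∸m]≡n qy≤k)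
        where
          y≡ : y ≡ m * q y
          y≡ = Y-multiple Yy
          qy≤k : q y ≤ k
          qy≤k = *-cancelˡ-≤ m (subst (_≤ m * k) y≡ (subst (y ≤_) (sym mk≡x+y) (m≤n+m y x)))
          x≡ : x ≡ m * (k ∸ q y)
          x≡ = trans (+-*-∸-cancel m qy≤k (trans (cong (x +_) (sym y≡)) (trans (sym mk≡x+y) (sym (+-identityʳ _)))))
                     (+-identityʳ _)
      sum<n₁ : ∀ {u v} → Y₁ u ≡ true → X₁ v ≡ true → u + v < n₁
      sum<n₁ {u} {v} Ymu Xmv = *-cancelˡ-< m (u + v) n₁
        (subst₂ _<_ (m*-+ u v) n≡m*n₁ (sum<n Xmv Ymu))
      unique₁ : ∀ {u v u' v'} → Y₁ u ≡ true → X₁ v ≡ true → Y₁ u' ≡ true → X₁ v' ≡ true →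
                u + v ≡ u' + v' → u ≡ u'
      unique₁ {u} {v} {u'} {v'} Ymu Xmv Ymu' Xmv' eq = *-cancelˡ-≡ u u' m
        (unique′ Xmv Ymu Xmv' Ymu' (trans (m*-+ u v) (trans (cong (m *_) eq) (sym (m*-+ u' v')))))

  count-X : count n X ≡ m * count n₁ X₁
  count-X = trans (cong (λ N → count N X) n≡m*n₁)
    (count-blocks m n₁ X X₁ (λ j i i<m → proj₁ (blockShape j i i<m)))

  count-Y : count n Y ≡ count n₁ Y₁
  count-Y = trans (cong (λ N → count N Y) n≡m*n₁) (count-block-starts m₀ n₁ Y off-start)
    where
      off-start : ∀ j i → 0 < i → i < m → Y (m * j + i) ≡ false
      off-start j i 0<i i<m = ¬-not λ Ymji → <⇒≢ 0<i (sym (proj₂ (blockShape j i i<m) Ymji))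

-- Radix forms

-- For radices m₁, m₂, … every z < m₁ m₂ ⋯ has mixed-radix digits; OddPlaces says that the digits
-- at the places 2, 4, … vanish, EvenPlaces that those at the places 1, 3, … vanish.
mutual
  OddPlaces : List ℕ → ℕ → Set
  OddPlaces []       z = z ≡ 0
  OddPlaces (m ∷ ms) z = ∃₂ λ u v → u < m × EvenPlaces ms v × z ≡ u + m * v

  EvenPlaces : List ℕ → ℕ → Set
  EvenPlaces []       z = z ≡ 0
  EvenPlaces (m ∷ ms) z = ∃ λ v → OddPlaces ms v × z ≡ m * v

AlternatelyDivide : List ℕ → ℕ → ℕ → Set
AlternatelyDivide []       a b = ⊤
AlternatelyDivide (m ∷ ms) a b = m ∣ a × AlternatelyDivide ms b a

AlternatelyDivide-∣ : ∀ ms {a b a' b'} → a ∣ a' → b ∣ b' → AlternatelyDivide ms a b → AlternatelyDivide ms a' b'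
AlternatelyDivide-∣ []       _   _   _              = tt
AlternatelyDivide-∣ (m ∷ ms) a∣a' b∣b' (m∣a , rest) = ∣-trans m∣a a∣a' , AlternatelyDivide-∣ ms b∣b' a∣a' rest

record RadixForm (n : ℕ) (X Y : ℕ → Bool) : Set where
  field
    radices   : List ℕ
    radices≥2 : All (2 ≤_) radices
    product≡n : product radices ≡ n
    X⇔odd     : ∀ z → X z ≡ true ⇔ OddPlaces radices z
    Y⇔even    : ∀ z → Y z ≡ true ⇔ EvenPlaces radices z
    divide    : AlternatelyDivide radices (count n X) (count n Y)

module _ {X Y} (T : Tiling 1 X Y) where
  open TilingProperties.Nonempty T z<s

  unit-radixForm : RadixForm 1 X Y
  unit-radixForm = record
    { radices   = []
    ; radices≥2 = []
    ; product≡n = refl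
    ; X⇔odd     = λ z → mk⇔ (n<1⇒n≡0 ∘ X-<) λ { refl → X-zero }
    ; Y⇔even    = λ z → mk⇔ (n<1⇒n≡0 ∘ Y-<) λ { refl → Y-zero }
    ; divide    = tt
    }

module _ {n X Y} (T : Tiling n X Y) (0<n : 0 < n) (m₀ : ℕ)
  (X-initial : ∀ z → z < suc m₀ → X z ≡ true) (X-m : X (suc m₀) ≡ false) where
  open BlockStructure T 0<n m₀ X-initial X-m

  extend-radixForm : 1 ≤ m₀ → RadixForm n₁ Y₁ X₁ → RadixForm n X Y
  extend-radixForm 1≤m₀ R = record
    { radices   = m ∷ R.radices
    ; radices≥2 = s≤s 1≤m₀ ∷ R.radices≥2
    ; product≡n = trans (cong (m *_) R.product≡n) (sym n≡m*n₁)
    ; X⇔odd     = λ z → mk⇔ (X⇒odd z) X⇐odd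
    ; Y⇔even    = λ z → mk⇔ (Y⇒even z) Y⇐even
    ; divide    = subst (m ∣_) (sym count-X) (m∣m*n (count n₁ X₁)) ,
                  AlternatelyDivide-∣ R.radices (∣-reflexive (sym count-Y)) (subst (count n₁ X₁ ∣_) (sym count-X) (n∣m*n m))
                    R.divide
    }
    where
      module R = RadixForm R
      X⇒odd : ∀ z → X z ≡ true → OddPlaces (m ∷ R.radices) z
      X⇒odd z Xz = r z , q z , r<m z , Equivalence.to (R.Y⇔even (q z)) (trans (sym (X-blockwise z)) Xz) ,
                   trans (div-mod z) (+-comm (m * q z) (r z))
      X⇐odd : ∀ {z} → OddPlaces (m ∷ R.radices) z → X z ≡ true
      X⇐odd (u , v , u<m , even , refl) = trans (cong X (+-comm u (m * v)))
        (trans (proj₁ (blockShape v u u<m)) (Equivalence.from (R.Y⇔even v) even))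
      Y⇒even : ∀ z → Y z ≡ true → EvenPlaces (m ∷ R.radices) z
      Y⇒even z Yz = q z , Equivalence.to (R.X⇔odd (q z)) (subst (λ w → Y w ≡ true) (Y-multiple Yz) Yz) , Y-multiple Yz
      Y⇐even : ∀ {z} → EvenPlaces (m ∷ R.radices) z → Y z ≡ true
      Y⇐even (v , odd , refl) = Equivalence.from (R.X⇔odd v) odd

radixForm : ∀ n {X Y} → 0 < n → Tiling n X Y → Y 1 ≡ false → RadixForm n X Y
radixForm = <-rec _ step
  where
    step : ∀ n → (∀ {n₁} → n₁ < n → ∀ {X Y} → 0 < n₁ → Tiling n₁ X Y → Y 1 ≡ false → RadixForm n₁ X Y) →
           ∀ {X Y} → 0 < n → Tiling n X Y → Y 1 ≡ false → RadixForm n X Y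
    step (suc zero)    _  _       T _     = unit-radixForm T
    step (suc (suc _)) IH {X} 0<n T Y-one
      with least-false X (TilingProperties.Nonempty.X-≥ T 0<n ≤-refl)
    ... | zero , _ , X-0     = ⊥-elim (false⇒≢true X-0 (TilingProperties.Nonempty.X-zero T 0<n))
    ... | suc zero , _ , X-1 = ⊥-elim (false⇒≢true X-1 (TilingProperties.X-one T (s<s z<s) Y-one))
    ... | suc (suc m₁) , X-initial , X-m =
      extend-radixForm T 0<n (suc m₁) X-initial X-m z<s (IH (n₁<n z<s) 0<n₁ reduced X₁-one)
      where open BlockStructure T 0<n (suc m₁) X-initial X-m

radixForm± : ∀ {n X Y} → 0 < n → Tiling n X Y → RadixForm n X Y ⊎ (1 < n × RadixForm n Y X)
radixForm± {n} {X} {Y} 0<n T with Y 1 Bool.≟ true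
... | no  Y-one = inj₁ (radixForm n 0<n T (¬-not Y-one))
... | yes Y-one = inj₂ (Y-< Y-one , radixForm n 0<n (swap-tiling T) (¬-not λ X-one → 1≢0 (X∩Y⊆0 X-one Y-one)))
  where
    open TilingProperties.Nonempty T 0<n
    1≢0 : 1 ≢ 0
    1≢0 ()

radices-determine : ∀ {n n' X Y X' Y'} (R : RadixForm n X Y) (R' : RadixForm n' X' Y') →
  RadixForm.radices R ≡ RadixForm.radices R' →
  (∀ z → X z ≡ true → X' z ≡ true) × (∀ z → Y z ≡ true → Y' z ≡ true)
radices-determine R R' same =
  (λ z → Equivalence.from (R'.X⇔odd z) ∘ subst (λ rs → OddPlaces rs z) same ∘ Equivalence.to (R.X⇔odd z)) ,
  (λ z → Equivalence.from (R'.Y⇔even z) ∘ subst (λ rs → EvenPlaces rs z) same ∘ Equivalence.to (R.Y⇔even z))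
  where
    module R = RadixForm R
    module R' = RadixForm R'

-- Sumsets A + B = [n] as tilings

sorted⇒unique : ∀ {A} → FinSetℤ A → Unique A
sorted⇒unique A< = AllPairs.map ℤ.<⇒≢ (Linked⇒AllPairs ℤ.<-trans A<)

infix 5 _∈ᵇ_

_∈ᵇ_ : ℤ → List ℤ → Bool
z ∈ᵇ A = does (z ∈ℤ? A)

∈ᵇ⇒∈ : ∀ {z A} → z ∈ᵇ A ≡ true → z ∈ A
∈ᵇ⇒∈ {z} {A} with z ∈ℤ? A
... | yes z∈A = λ _ → z∈A

∈⇒∈ᵇ : ∀ {z A} → z ∈ A → z ∈ᵇ A ≡ true
∈⇒∈ᵇ = dec-true (_ ∈ℤ? _)

∈ᵇ-⊆ : (f : ℕ → ℤ) {A A' : List ℤ} → (∀ {a} → a ∈ A → ∃ λ x → a ≡ f x) →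
  (∀ x → f x ∈ᵇ A ≡ true → f x ∈ᵇ A' ≡ true) → A ⊆ A'
∈ᵇ-⊆ f A⊆f[ℕ] f⁻¹A⊆f⁻¹A' a∈ with x , refl ← A⊆f[ℕ] a∈ = ∈ᵇ⇒∈ (f⁻¹A⊆f⁻¹A' x (∈⇒∈ᵇ a∈))

length-filter-applyUpTo : ∀ N (f : ℕ → ℕ) (p : ℕ → Bool) →
  length (filter (λ z → p z Bool.≟ true) (applyUpTo f N)) ≡ count N (p ∘ f)
length-filter-applyUpTo zero    f p = refl
length-filter-applyUpTo (suc N) f p with p (f 0)
... | true  = cong suc (length-filter-applyUpTo N (f ∘ suc) p)
... | false = length-filter-applyUpTo N (f ∘ suc) p

count-∈ᵇ : (f : ℕ → ℤ) → (∀ {x y} → f x ≡ f y → x ≡ y) → ∀ n {A} → Unique A →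
  (∀ {a} → a ∈ A → ∃ λ x → x < n × a ≡ f x) → count n (λ x → f x ∈ᵇ A) ≡ length A
count-∈ᵇ f f-injective n {A} A! A⊆f[n] = begin
  count n p         ≡⟨ length-filter-applyUpTo n id p ⟨
  length S          ≡⟨ length-map f S ⟨
  length (map f S)  ≡⟨ Unique-⊆-⊇⇒length-≡ (Unique.map⁺ f-injective (Unique.filter⁺ P? (Unique.upTo⁺ n))) A! f[S]⊆A A⊆f[S] ⟩
  length A          ∎
  where
    open ≡-Reasoning
    p : ℕ → Bool
    p x = f x ∈ᵇ A
    P? = λ x → p x Bool.≟ true
    S = filter P? (upTo n)
    f[S]⊆A : map f S ⊆ A
    f[S]⊆A fx∈ with x , x∈S , refl ← ∈-map⁻ f fx∈ = ∈ᵇ⇒∈ (proj₂ (∈-filter⁻ P? {xs = upTo n} x∈S))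
    A⊆f[S] : A ⊆ map f S
    A⊆f[S] a∈ with x , x<n , refl ← A⊆f[n] a∈ = ∈-map⁺ f (∈-filter⁺ P? (∈-upTo⁺ x<n) (∈⇒∈ᵇ a∈))

A-1 : List ℤ → ℕ → Bool
A-1 A x = ℤ.+ suc x ∈ᵇ A

Bℕ : List ℤ → ℕ → Bool
Bℕ B y = ℤ.+ y ∈ᵇ B

+suc-injective : ∀ {x y} → ℤ.+ suc x ≡ ℤ.+ suc y → x ≡ y
+suc-injective = suc-injective ∘ ℤ.+-injective

module SumsetTiling {α n A B} (0<n : 0 < n) (H : In𝒯 α n A B) where

  A< : FinSetℤ A
  A< = H .proj₁

  B< : FinSetℤ B
  B< = H .proj₂ .proj₁

  private
    A+B≡[n] : SumIsInterval A B n
    A+B≡[n] = H .proj₂ .proj₂ .proj₁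
    n≡|A||B| : n ≡ length A * length B
    n≡|A||B| = H .proj₂ .proj₂ .proj₂ .proj₁
    |A|≡α : length A ≡ α
    |A|≡α = H .proj₂ .proj₂ .proj₂ .proj₂ .proj₁
    0∈B : ℤ.+ 0 ∈ B
    0∈B = H .proj₂ .proj₂ .proj₂ .proj₂ .proj₂ .proj₁
    B≥0 : All (ℤ.+ 0 ℤ.≤_) B
    B≥0 = H .proj₂ .proj₂ .proj₂ .proj₂ .proj₂ .proj₂

  private
    sum∈[n] : ∀ {a b} → a ∈ A → b ∈ B → In[ n ] (a ℤ.+ b)
    sum∈[n] a∈ b∈ = Equivalence.from (A+B≡[n] _) (_ , _ , a∈ , b∈ , refl)

  A-positive : ∀ {a} → a ∈ A → ∃ λ x → a ≡ ℤ.+ suc x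
  A-positive {a} a∈ = positive a (proj₁ (subst In[ n ] (ℤ.+-identityʳ a) (sum∈[n] a∈ 0∈B)))
    where
      positive : ∀ a → ℤ.+ 1 ℤ.≤ a → ∃ λ x → a ≡ ℤ.+ suc x
      positive (ℤ.+ suc x)  _               = x , refl
      positive (ℤ.+ zero)   (ℤ.+≤+ ())
      positive -[1+ _ ]   ()

  B-natural : ∀ {b} → b ∈ B → ∃ λ y → b ≡ ℤ.+ y
  B-natural {b} b∈ = natural b (All.lookup B≥0 b∈)
    where
      natural : ∀ b → ℤ.+ 0 ℤ.≤ b → ∃ λ y → b ≡ ℤ.+ y
      natural (ℤ.+ y)    _  = y , refl
      natural -[1+ _ ] ()

  sum-injective : ∀ {a b a' b'} → a ∈ A → b ∈ B → a' ∈ A → b' ∈ B →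
    a ℤ.+ b ≡ a' ℤ.+ b' → (a , b) ≡ (a' , b')
  sum-injective a∈ b∈ a'∈ b'∈ = ⊆-map⇒injective (×-≡-dec ℤ._≟_ ℤ._≟_) (uncurry ℤ._+_)
    interval! interval⊆A+B |A×B|≤n (∈-cartesianProduct⁺ a∈ b∈) (∈-cartesianProduct⁺ a'∈ b'∈)
    where
      interval : List ℤ
      interval = map (λ k → ℤ.+ suc k) (upTo n)
      interval! : Unique interval
      interval! = Unique.map⁺ +suc-injective (Unique.upTo⁺ n)
      interval⊆A+B : interval ⊆ map (uncurry ℤ._+_) (cartesianProduct A B)
      interval⊆A+B z∈ with k , k∈ , refl ← ∈-map⁻ _ z∈
        with a , b , a∈ , b∈ , eq ← Equivalence.to (A+B≡[n] (ℤ.+ suc k)) (ℤ.+≤+ (s≤s z≤n) , ℤ.+≤+ (∈-upTo⁻ k∈)) =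
        subst (_∈ _) (sym eq) (∈-map⁺ (uncurry ℤ._+_) (∈-cartesianProduct⁺ a∈ b∈))
      |A×B|≤n : length (cartesianProduct A B) ≤ length interval
      |A×B|≤n = ≤-reflexive (begin
        length (cartesianProduct A B)   ≡⟨ length-cartesianProductWith _,_ A B ⟩
        length A * length B             ≡⟨ n≡|A||B| ⟨
        n                               ≡⟨ length-upTo n ⟨
        length (upTo n)                 ≡⟨ length-map _ (upTo n) ⟨
        length interval                 ∎)
        where open ≡-Reasoning

  tiling : Tiling n (A-1 A) (Bℕ B)
  tiling = record { cover = cover ; sum<n = sum<n ; unique = unique }
    where
      cover : ∀ z → z < n → ∃₂ λ x y → A-1 A x ≡ true × Bℕ B y ≡ true × z ≡ x + y
      cover z z<n with a , b , a∈ , b∈ , eq ← Equivalence.to (A+B≡[n] (ℤ.+ suc z)) (ℤ.+≤+ (s≤s z≤n) , ℤ.+≤+ z<n)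
        with x , refl ← A-positive a∈ | y , refl ← B-natural b∈ =
        x , y , ∈⇒∈ᵇ a∈ , ∈⇒∈ᵇ b∈ , +suc-injective eq
      sum<n : ∀ {x y} → A-1 A x ≡ true → Bℕ B y ≡ true → x + y < n
      sum<n Xx Yy = ℤ.drop‿+≤+ (proj₂ (sum∈[n] (∈ᵇ⇒∈ Xx) (∈ᵇ⇒∈ Yy)))
      unique : ∀ {x y x' y'} → A-1 A x ≡ true → Bℕ B y ≡ true → A-1 A x' ≡ true → Bℕ B y' ≡ true →
               x + y ≡ x' + y' → x ≡ x'
      unique Xx Yy Xx' Yy' eq = +suc-injective (cong proj₁
        (sum-injective (∈ᵇ⇒∈ Xx) (∈ᵇ⇒∈ Yy) (∈ᵇ⇒∈ Xx') (∈ᵇ⇒∈ Yy') (cong (λ k → ℤ.+ suc k) eq)))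

  open TilingProperties.Nonempty tiling 0<n using (X-<; Y-<)

  count-A-1 : count n (A-1 A) ≡ α
  count-A-1 = trans (count-∈ᵇ (λ x → ℤ.+ suc x) +suc-injective n (sorted⇒unique A<) A⊆[n]) |A|≡α
    where
      A⊆[n] : ∀ {a} → a ∈ A → ∃ λ x → x < n × a ≡ ℤ.+ suc x
      A⊆[n] a∈ with x , refl ← A-positive a∈ = x , X-< (∈⇒∈ᵇ a∈) , refl

  count-Bℕ : ∀ {β} → n ≡ β * α → count n (Bℕ B) ≡ β
  count-Bℕ {β} n≡βα = trans (count-∈ᵇ ℤ.+_ ℤ.+-injective n (sorted⇒unique B<) B⊆[n]) |B|≡β
    where
      |B|≡β : length B ≡ β
      |B|≡β = *-cancelˡ-≡ (length B) β α ⦃ >-nonZero 0<α ⦄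
        (trans (cong (_* length B) (sym |A|≡α)) (trans (sym n≡|A||B|) (trans n≡βα (*-comm β α))))
        where
          0<α : 0 < α
          0<α = n≢0⇒n>0 λ α≡0 → <⇒≢ 0<n (sym (trans n≡|A||B| (trans (cong (_* length B) (trans |A|≡α α≡0)) refl)))
      B⊆[n] : ∀ {b} → b ∈ B → ∃ λ y → y < n × b ≡ ℤ.+ y
      B⊆[n] b∈ with y , refl ← B-natural b∈ = y , Y-< (∈⇒∈ᵇ b∈) , refl

-- Encoding radix forms by words

pairUp : {A : Set} → List A → List (A × A)
pairUp (a ∷ b ∷ rest) = (a , b) ∷ pairUp rest
pairUp _              = []

length-pairUp-< : {A : Set} (a : A) (as : List A) → length (pairUp (a ∷ as)) < length (a ∷ as)
length-pairUp-< a []             = z<s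
length-pairUp-< a (b ∷ [])       = s<s z<s
length-pairUp-< a (b ∷ c ∷ rest) = s<s (m<n⇒m<1+n (length-pairUp-< c rest))

length-pairUp-≤ : {A : Set} (as : List A) → length (pairUp as) ≤ length as
length-pairUp-≤ []       = z≤n
length-pairUp-≤ (a ∷ as) = <⇒≤ (length-pairUp-< a as)

2^length≤product : ∀ {ms} → All (2 ≤_) ms → 2 ^ length ms ≤ product ms
2^length≤product []         = ≤-refl
2^length≤product (2≤m ∷ ms) = *-mono-≤ 2≤m (2^length≤product ms)

-- An odd-length radix list loses its last entry under pairUp; the product recovers it.
pairUp-injective : ∀ {ms ms'} → All (2 ≤_) ms → All (2 ≤_) ms' → product ms ≡ product ms' →
  pairUp ms ≡ pairUp ms' → ms ≡ ms'
pairUp-injective []          []          _  _ = refl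
pairUp-injective []          (2≤m ∷ [])  eq _ = ⊥-elim (<⇒≱ 2≤m (≤-reflexive (trans (sym (*-identityʳ _)) (sym eq))))
pairUp-injective (2≤m ∷ [])  []          eq _ = ⊥-elim (<⇒≱ 2≤m (≤-reflexive (trans (sym (*-identityʳ _)) eq)))
pairUp-injective (_ ∷ [])    (_ ∷ [])    eq _ = cong [_] (trans (sym (*-identityʳ _)) (trans eq (*-identityʳ _)))
pairUp-injective {a ∷ b ∷ _} (2≤a ∷ 2≤b ∷ ms≥2) (_ ∷ _ ∷ ms'≥2) eq pe with refl , pe′ ← ∷-injective pe =
  cong (λ rest → a ∷ b ∷ rest) (pairUp-injective ms≥2 ms'≥2 (*-cancelˡ-≡ _ _ b ⦃ nz 2≤b ⦄ (*-cancelˡ-≡ _ _ a ⦃ nz 2≤a ⦄ eq)) pe′)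
  where
    nz : ∀ {m} → 2 ≤ m → ℕ.NonZero m
    nz 2≤m = >-nonZero (<-trans z<s 2≤m)
pairUp-injective []                (_ ∷ _ ∷ _) _ ()
pairUp-injective (_ ∷ [])          (_ ∷ _ ∷ _) _ ()
pairUp-injective (_ ∷ _ ∷ _)       []          _ ()
pairUp-injective (_ ∷ _ ∷ _)       (_ ∷ [])    _ ()

Symbol : Set
Symbol = Maybe (ℕ × ℕ)

pad : ℕ → List Symbol → List Symbol
pad e w = w ++ replicate (e ∸ length w) nothing

length-pad : ∀ e w → length w ≤ e → length (pad e w) ≡ e
length-pad e w |w|≤e =
  trans (length-++ w) (trans (cong (length w +_) (length-replicate (e ∸ length w))) (m+[n∸m]≡n |w|≤e))

just-++-nothing-injective : ∀ (ps ps' : List (ℕ × ℕ)) k k' →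
  map just ps ++ replicate k nothing ≡ map just ps' ++ replicate k' nothing → ps ≡ ps'
just-++-nothing-injective []       []         _       _       _  = refl
just-++-nothing-injective []       (_ ∷ _)    zero    _       ()
just-++-nothing-injective []       (_ ∷ _)    (suc _) _       ()
just-++-nothing-injective (_ ∷ _)  []         _       zero    ()
just-++-nothing-injective (_ ∷ _)  []         _       (suc _) ()
just-++-nothing-injective (p ∷ ps) (_ ∷ ps')  k       k'      eq with refl , eq′ ← ∷-injective eq =
  cong (p ∷_) (just-++-nothing-injective ps ps' k k' eq′)

nothing∷-≢-replicate : ∀ e (ps : List (ℕ × ℕ)) k → replicate e nothing ≡ nothing ∷ (map just ps ++ replicate k nothing) → ps ≡ []
nothing∷-≢-replicate zero    ps k ()
nothing∷-≢-replicate (suc e) ps k eq = sym (just-++-nothing-injective [] ps e k (∷-injectiveʳ eq))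

divisors≥2 : ℕ → List ℕ
divisors≥2 m = filter (_∣? m) (applyUpTo (2 +_) (m ∸ 1))

σ₀-suc : ∀ k → σ₀ (suc k) ≡ suc (length (divisors≥2 (suc k)))
σ₀-suc k = cong length (filter-accept (_∣? suc k) (1∣ suc k))

∈-divisors≥2 : ∀ {u m} → 0 < m → u ∣ m → 2 ≤ u → u ∈ divisors≥2 m
∈-divisors≥2 {suc (suc u)} {suc k} _ u∣m _ =
  ∈-filter⁺ (_∣? suc k) (∈-applyUpTo⁺ (2 +_) (s≤s⁻¹ (∣⇒≤ u∣m))) u∣m
∈-divisors≥2 {suc zero} _ _ (s≤s ())

Alphabet : ℕ → ℕ → List Symbol
Alphabet a b = nothing ∷ map just (cartesianProduct (divisors≥2 a) (divisors≥2 b))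

length-Alphabet : ∀ {a b} → 0 < a → 0 < b → length (Alphabet a b) ≡ base a b
length-Alphabet {suc a} {suc b} _ _ rewrite σ₀-suc a | σ₀-suc b = begin
  suc (length (map just (cartesianProduct Da Db)))  ≡⟨ cong suc (length-map just (cartesianProduct Da Db)) ⟩
  suc (length (cartesianProduct Da Db))             ≡⟨ cong suc (length-cartesianProductWith _,_ Da Db) ⟩
  suc (length Da * length Db)                       ≡⟨ base-suc (length Da) (length Db) ⟨
  suc (length Da) * suc (length Db) + 2 ∸ suc (length Da) ∸ suc (length Db) ∎
  where
    open ≡-Reasoning
    Da = divisors≥2 (suc a)
    Db = divisors≥2 (suc b)
    base-suc : ∀ s t → suc s * suc t + 2 ∸ suc s ∸ suc t ≡ suc (s * t)
    base-suc s t = begin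
      suc s * suc t + 2 ∸ suc s ∸ suc t            ≡⟨ cong (λ k → k ∸ suc s ∸ suc t) (expand s t) ⟩
      suc s + (suc t + suc (s * t)) ∸ suc s ∸ suc t ≡⟨ cong (_∸ suc t) (m+n∸m≡n (suc s) _) ⟩
      suc t + suc (s * t) ∸ suc t                  ≡⟨ m+n∸m≡n (suc t) _ ⟩
      suc (s * t)                                  ∎
      where
        expand : ∀ s t → suc s * suc t + 2 ≡ suc s + (suc t + suc (s * t))
        expand = solve-∀

pairUp-divisors : ∀ {ms a b} → 0 < a → 0 < b → All (2 ≤_) ms → AlternatelyDivide ms a b →
  All (λ p → proj₁ p ∈ divisors≥2 a × proj₂ p ∈ divisors≥2 b) (pairUp ms)
pairUp-divisors {[]}        _   _   _ _ = []
pairUp-divisors {_ ∷ []}    _   _   _ _ = []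
pairUp-divisors {_ ∷ _ ∷ _} 0<a 0<b (2≤u ∷ 2≤v ∷ ms≥2) (u∣a , v∣b , rest) =
  (∈-divisors≥2 0<a u∣a 2≤u , ∈-divisors≥2 0<b v∣b 2≤v) ∷ pairUp-divisors 0<a 0<b ms≥2 rest

≤⌊log₂⌋ : ∀ {a n} → 2 ^ a ≤ n → a ≤ ⌊log₂ n ⌋
≤⌊log₂⌋ {a} 2^a≤n = subst (_≤ _) (⌊log₂[2^n]⌋≡n a) (⌊log₂⌋-mono-≤ 2^a≤n)

2^-cancel-≤ : ∀ {a b} → 2 ^ a ≤ 2 ^ b → a ≤ b
2^-cancel-≤ {b = b} 2^a≤2^b = subst (_ ≤_) (⌊log₂[2^n]⌋≡n b) (≤⌊log₂⌋ 2^a≤2^b)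

2^⌊log₂⌋≤ : ∀ n → 0 < n → 2 ^ ⌊log₂ n ⌋ ≤ n
2^⌊log₂⌋≤ = <-rec _ bound
  where
    bound : ∀ n → (∀ {h} → h < n → 0 < h → 2 ^ ⌊log₂ h ⌋ ≤ h) → 0 < n → 2 ^ ⌊log₂ n ⌋ ≤ n
    bound (suc zero)      _  _ = ≤-refl
    bound n@(suc (suc k)) IH _ = begin
      2 ^ ⌊log₂ n ⌋                 ≡⟨ cong (λ l → 2 * 2 ^ l) (⌊log₂⌊n/2⌋⌋≡⌊log₂n⌋∸1 n) ⟨
      2 * 2 ^ ⌊log₂ ⌊ n /2⌋ ⌋        ≤⟨ *-monoʳ-≤ 2 (IH (⌊n/2⌋<n (suc k)) z<s) ⟩
      2 * ⌊ n /2⌋                   ≤⟨ +-monoʳ-≤ ⌊ n /2⌋ (+-monoˡ-≤ 0 (⌊n/2⌋≤⌈n/2⌉ n)) ⟩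
      ⌊ n /2⌋ + (⌈ n /2⌉ + 0)        ≡⟨ cong (⌊ n /2⌋ +_) (+-identityʳ _) ⟩
      ⌊ n /2⌋ + ⌈ n /2⌉              ≡⟨ ⌊n/2⌋+⌈n/2⌉≡n n ⟩
      n                             ∎
      where open ≤-Reasoning

≤^log-intro : ∀ {t x e n} → 0 < x → t ≤ x ^ e → 2 ^ e ≤ n → ≤^log t x n
≤^log-intro {t} {x} {e} {n} 0<x t≤x^e 2^e≤n p q n^q≤2^p = begin
  t ^ suc q        ≤⟨ ^-monoˡ-≤ (suc q) t≤x^e ⟩
  (x ^ e) ^ suc q  ≡⟨ ^-*-assoc x e (suc q) ⟩
  x ^ (e * suc q)  ≤⟨ ^-monoʳ-≤ x ⦃ >-nonZero 0<x ⦄ (2^-cancel-≤ {e * suc q} {p} 2^eq≤2^p) ⟩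
  x ^ p            ∎
  where
    open ≤-Reasoning
    2^eq≤2^p : 2 ^ (e * suc q) ≤ 2 ^ p
    2^eq≤2^p = ≤-trans (≤-reflexive (sym (^-*-assoc 2 e (suc q)))) (≤-trans (^-monoˡ-≤ (suc q) 2^e≤n) n^q≤2^p)

pad-just≡pad-nothing : ∀ e (ps ps' : List (ℕ × ℕ)) →
  pad e (map just ps) ≡ pad e (nothing ∷ map just ps') → ps ≡ [] × ps' ≡ []
pad-just≡pad-nothing e       (_ ∷ _) _   eq with () ← ∷-injectiveˡ eq
pad-just≡pad-nothing zero    []      _   ()
pad-just≡pad-nothing (suc e) []      ps' eq = refl , sym (just-++-nothing-injective [] ps' e _ (∷-injectiveʳ eq))

swap-injective : {A B : Set} {p q : A × B} → swap p ≡ swap q → p ≡ q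
swap-injective refl = refl

pairUp≡[]⇒single : ∀ {ms n} → All (2 ≤_) ms → product ms ≡ n → 1 < n → pairUp ms ≡ [] → ms ≡ [ n ]
pairUp≡[]⇒single []         refl 1<n _ = ⊥-elim (<-irrefl refl 1<n)
pairUp≡[]⇒single (_ ∷ [])   eq   _   _ = cong [_] (trans (sym (*-identityʳ _)) eq)

pairUp-< : ∀ {ms n} → product ms ≡ n → 1 < n → suc (length (pairUp ms)) ≤ length ms
pairUp-< {[]}     refl 1<n = ⊥-elim (<-irrefl refl 1<n)
pairUp-< {m ∷ ms} _    _   = length-pairUp-< m ms

¬both-divide : ∀ {n α β} → 1 < n → n ≡ β * α → n ∣ α → n ∣ β → ⊥
¬both-divide {n} {α} {β} 1<n n≡βα n∣α n∣β = <⇒≱ 1<n (*-cancelˡ-≤ n ⦃ >-nonZero 0<n ⦄ n*n≤n*1)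
  where
    0<n : 0 < n
    0<n = <-trans z<s 1<n
    nonZero : ∀ j {k} → n ≡ j * k → ℕ.NonZero k
    nonZero j {zero}  eq = ⊥-elim (<⇒≢ 0<n (sym (trans eq (*-zeroʳ j))))
    nonZero j {suc _} _  = _
    n*n≤n*1 : n * n ≤ n * 1
    n*n≤n*1 = ≤-trans (*-mono-≤ (∣⇒≤ ⦃ nonZero α (trans n≡βα (*-comm β α)) ⦄ n∣β) (∣⇒≤ ⦃ nonZero β n≡βα ⦄ n∣α))
                (≤-reflexive (trans (sym n≡βα) (sym (*-identityʳ n))))

module _ {n X Y X' Y'} (R : RadixForm n X Y) (R' : RadixForm n X' Y') where
  private
    module R = RadixForm R
    module R' = RadixForm R'

  radices-≡ : pairUp R.radices ≡ pairUp R'.radices → R.radices ≡ R'.radices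
  radices-≡ = pairUp-injective R.radices≥2 R'.radices≥2 (trans R.product≡n (sym R'.product≡n))

first-radix : ∀ {n X Y a b} (R : RadixForm n X Y) → 1 < n →
  AlternatelyDivide (RadixForm.radices R) a b → pairUp (RadixForm.radices R) ≡ [] → n ∣ a
first-radix R 1<n divide ps≡[] = proj₁ (subst (λ rs → AlternatelyDivide rs _ _)
  (pairUp≡[]⇒single (RadixForm.radices≥2 R) (RadixForm.product≡n R) 1<n ps≡[]) divide)

module Sumsets {α β n} (0<α : 0 < α) (0<n : 0 < n) (n≡βα : n ≡ β * α) where

  0<β : 0 < β
  0<β = n≢0⇒n>0 λ β≡0 → <⇒≢ 0<n (sym (trans n≡βα (cong (_* α) β≡0)))

  e : ℕ
  e = ⌊log₂ n ⌋

  data Form (A B : List ℤ) : Set where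
    forward  : RadixForm n (A-1 A) (Bℕ B) → Form A B
    backward : 1 < n → RadixForm n (Bℕ B) (A-1 A) → Form A B

  form : ∀ {A B} → In𝒯 α n A B → Form A B
  form H with radixForm± 0<n (SumsetTiling.tiling 0<n H)
  ... | inj₁ R         = forward R
  ... | inj₂ (1<n , R) = backward 1<n R

  -- Backward radices alternately divide β and α, hence the swap.
  encode : ∀ {A B} → Form A B → List Symbol
  encode (forward R)    = pad e (map just (pairUp (RadixForm.radices R)))
  encode (backward _ R) = pad e (nothing ∷ map just (map swap (pairUp (RadixForm.radices R))))

  private
    dividesαβ : ∀ {A B} → In𝒯 α n A B → (R : RadixForm n (A-1 A) (Bℕ B)) →
      AlternatelyDivide (RadixForm.radices R) α β
    dividesαβ H R = subst₂ (AlternatelyDivide _) (count-A-1 H) (count-Bℕ H n≡βα) (RadixForm.divide R)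
      where open SumsetTiling 0<n

    dividesβα : ∀ {A B} → In𝒯 α n A B → (R : RadixForm n (Bℕ B) (A-1 A)) →
      AlternatelyDivide (RadixForm.radices R) β α
    dividesβα H R = subst₂ (AlternatelyDivide _) (count-Bℕ H n≡βα) (count-A-1 H) (RadixForm.divide R)
      where open SumsetTiling 0<n

  sumset-≡ : ∀ {A B A' B'} → In𝒯 α n A B → In𝒯 α n A' B' →
    (∀ x → A-1 A x ≡ true → A-1 A' x ≡ true) × (∀ y → Bℕ B y ≡ true → Bℕ B' y ≡ true) →
    (∀ x → A-1 A' x ≡ true → A-1 A x ≡ true) × (∀ y → Bℕ B' y ≡ true → Bℕ B y ≡ true) →
    (A , B) ≡ (A' , B')
  sumset-≡ H H' (A⊆A' , B⊆B') (A'⊆A , B'⊆B) = cong₂ _,_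
    (sorted-≡ S.A< S'.A< (∈ᵇ-⊆ (ℤ.+_ ∘ suc) S.A-positive A⊆A') (∈ᵇ-⊆ (ℤ.+_ ∘ suc) S'.A-positive A'⊆A))
    (sorted-≡ S.B< S'.B< (∈ᵇ-⊆ ℤ.+_ S.B-natural B⊆B') (∈ᵇ-⊆ ℤ.+_ S'.B-natural B'⊆B))
    where
      module S = SumsetTiling 0<n H
      module S' = SumsetTiling 0<n H'
      sorted-≡ : ∀ {xs ys} → FinSetℤ xs → FinSetℤ ys → xs ⊆ ys → ys ⊆ xs → xs ≡ ys
      sorted-≡ xs< ys< = sorted-⊆-⊇⇒≡ ℤ.<-irrefl ℤ.<-asym (Linked⇒AllPairs ℤ.<-trans xs<) (Linked⇒AllPairs ℤ.<-trans ys<)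

  -- The codes of the two orientations can only agree if both use the single radix n,
  -- which would then divide both α and β.
  orientations-differ : ∀ {A B A' B'} → In𝒯 α n A B → In𝒯 α n A' B' →
    (R : RadixForm n (A-1 A) (Bℕ B)) (R' : RadixForm n (Bℕ B') (A-1 A')) (1<n : 1 < n) →
    encode (forward {A} {B} R) ≢ encode (backward {A'} {B'} 1<n R')
  orientations-differ H H' R R' 1<n eq with ps≡[] , ps'≡[] ← pad-just≡pad-nothing e _ _ eq =
    ¬both-divide 1<n n≡βα (first-radix R 1<n (dividesαβ H R) ps≡[])
      (first-radix R' 1<n (dividesβα H' R') (List.map-injective swap-injective ps'≡[]))

  code-injective : ∀ {A B A' B'} (H : In𝒯 α n A B) (H' : In𝒯 α n A' B') →
    encode (form H) ≡ encode (form H') → (A , B) ≡ (A' , B')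
  code-injective {A} {B} {A'} {B'} H H' = go (form H) (form H')
    where
      go : (F : Form A B) (F' : Form A' B') → encode F ≡ encode F' → (A , B) ≡ (A' , B')
      go (forward R) (forward R') eq =
        sumset-≡ H H' (radices-determine R R' same) (radices-determine R' R (sym same))
        where
          same = radices-≡ R R' (just-++-nothing-injective _ _ _ _ eq)
      go (backward _ R) (backward _ R') eq =
        sumset-≡ H H' (swap (radices-determine R R' same)) (swap (radices-determine R' R (sym same)))
        where
          same = radices-≡ R R' (List.map-injective swap-injective (just-++-nothing-injective _ _ _ _ (∷-injectiveʳ eq)))
      go (forward R)      (backward 1<n R') eq = ⊥-elim (orientations-differ H H' R R' 1<n eq)
      go (backward 1<n R) (forward R')      eq = ⊥-elim (orientations-differ H' H R' R 1<n (sym eq))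

  length-radices : ∀ {X Y} (R : RadixForm n X Y) → length (RadixForm.radices R) ≤ e
  length-radices R = ≤⌊log₂⌋ (subst (2 ^ length rs ≤_) (RadixForm.product≡n R) (2^length≤product (RadixForm.radices≥2 R)))
    where rs = RadixForm.radices R

  length-encode : ∀ {A B} (F : Form A B) → length (encode F) ≡ e
  length-encode (forward R) = length-pad e (map just ps) (begin
    length (map just ps)  ≡⟨ length-map just ps ⟩
    length ps             ≤⟨ length-pairUp-≤ rs ⟩
    length rs             ≤⟨ length-radices R ⟩
    e                     ∎)
    where
      open ≤-Reasoning
      rs = RadixForm.radices R
      ps = pairUp rs
  length-encode (backward 1<n R) = length-pad e (nothing ∷ map just (map swap ps)) (begin
    suc (length (map just (map swap ps)))  ≡⟨ cong suc (trans (length-map just (map swap ps)) (length-map swap ps)) ⟩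
    suc (length ps)                        ≤⟨ pairUp-< {rs} (RadixForm.product≡n R) 1<n ⟩
    length rs                              ≤⟨ length-radices R ⟩
    e                                      ∎)
    where
      open ≤-Reasoning
      rs = RadixForm.radices R
      ps = pairUp rs

  encode-∈ : ∀ {A B} → In𝒯 α n A B → (F : Form A B) → All (_∈ Alphabet α β) (encode F)
  encode-∈ H (forward R) = AllP.++⁺
    (AllP.map⁺ (All.map pair∈ (pairUp-divisors 0<α 0<β (RadixForm.radices≥2 R) (dividesαβ H R))))
    (AllP.replicate⁺ _ (here refl))
    where
      pair∈ : ∀ {p} → proj₁ p ∈ divisors≥2 α × proj₂ p ∈ divisors≥2 β → just p ∈ Alphabet α β
      pair∈ (u∈ , v∈) = there (∈-map⁺ just (∈-cartesianProduct⁺ u∈ v∈))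
  encode-∈ H (backward _ R) = AllP.++⁺
    (here refl ∷ AllP.map⁺ (AllP.map⁺ (All.map pair∈ (pairUp-divisors 0<β 0<α (RadixForm.radices≥2 R) (dividesβα H R)))))
    (AllP.replicate⁺ _ (here refl))
    where
      pair∈ : ∀ {p} → proj₁ p ∈ divisors≥2 β × proj₂ p ∈ divisors≥2 α → just (swap p) ∈ Alphabet α β
      pair∈ (v∈ , u∈) = there (∈-map⁺ just (∈-cartesianProduct⁺ u∈ v∈))

  𝒯 : List ℤ × List ℤ → Set
  𝒯 (A , B) = In𝒯 α n A B

  code : ∀ {AB} → 𝒯 AB → List Symbol
  code {A , B} H = encode (form {A} {B} H)

  count-bound : ∀ {L} → Unique L → All 𝒯 L → length L ≤ length (Alphabet α β) ^ e
  count-bound L! L⊆𝒯 = subst (_ ≤_) (length-words e (Alphabet α β))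
    (length-≤-by-injection code (λ {AB} {AB'} → code-injective {proj₁ AB} {proj₂ AB} {proj₁ AB'} {proj₂ AB'})
      L! L⊆𝒯 code∈words)
    where
      code∈words : ∀ {AB} (H : 𝒯 AB) → code H ∈ words e (Alphabet α β)
      code∈words {A , B} H = subst (λ k → code H ∈ words k (Alphabet α β)) (length-encode (form {A} {B} H))
        (∈-words _ (encode-∈ H (form H)))

lemma8 : (α n : ℕ) → α ≥ 1 → n ≥ 1 → (d : α ∣ n) →
    (L : List (List ℤ × List ℤ)) → Unique L →
    All (λ AB → In𝒯 α n (proj₁ AB) (proj₂ AB)) L →
    ≤^log (length L) (base α (quotient d)) n
lemma8 α n α≥1 n≥1 d L L! L⊆𝒯 =
  ≤^log-intro {e = e} (subst (0 <_) |Alphabet|≡base z<s)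
    (subst (λ b → length L ≤ b ^ e) |Alphabet|≡base (count-bound L! L⊆𝒯))
    (2^⌊log₂⌋≤ n n≥1)
  where
    open Sumsets {β = quotient d} α≥1 n≥1 (_∣_.equality d)
    |Alphabet|≡base : length (Alphabet α (quotient d)) ≡ base α (quotient d)
    |Alphabet|≡base = length-Alphabet α≥1 0<β
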